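{- For infinitely many positive integers $n$, there is a function $\sigma\colon E(K_{4n})\to\{ -1,1\}$ with $\sigma(E(K_{4n}))=2$ such that $\sigma(M)\neq 0$ for every perfect matching $M$ in $K_{4n}$.
   Context: $K_{4n}$ denotes the complete graph on $4n$ vertices. For a set $F$ of edges, $\sigma(F)=\sum_{e\in F}\sigma(e)$. -}

module Defs where

open import Data.Nat using (ℕ; zero; suc)
open import Data.Fin using (Fin; zero; suc; _<_; _<?_)
open import Data.Integer using (ℤ; +_; -[1+_]; _+_)
open import Data.Product using (_×_)
open import Relation.Binary.PropositionalEquality using (_≡_; _≢_)
open import Relation.Nullary using (yes; no)

data Sign : Set where
  plus minus : Sign

⟦_⟧ : Sign → ℤ
⟦ plus ⟧  = + 1
⟦ minus ⟧ = -[1+ 0 ]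

∑ : (m : ℕ) → (Fin m → ℤ) → ℤ
∑ zero    f = + 0
∑ (suc m) f = f zero + ∑ m (λ i → f (suc i))

-- Vertices of K_m are Fin m; the edge {i,j} (i ≠ j) is represented by the
-- ordered pair (i , j) with i < j.  A labelling σ : E(K_m) → {-1,1} is thus a
-- function Fin m → Fin m → Sign of which only the values at i < j matter.
EdgeLabelling : ℕ → Set
EdgeLabelling m = Fin m → Fin m → Sign

edgeVal : {m : ℕ} → EdgeLabelling m → Fin m → Fin m → ℤ
edgeVal σ i j with i <? j
... | yes _ = ⟦ σ i j ⟧
... | no  _ = + 0

totalWeight : {m : ℕ} → EdgeLabelling m → ℤ
totalWeight {m} σ = ∑ m (λ i → ∑ m (λ j → edgeVal σ i j))

-- A perfect matching of K_m, given by its partner function: a fixed-point-free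
-- involution μ; the matching is M = { {i, μ i} : i ∈ Fin m }.
record PerfectMatching (m : ℕ) : Set where
  field
    partner     : Fin m → Fin m
    involutive  : ∀ i → partner (partner i) ≡ i
    no-fixpoint : ∀ i → partner i ≢ i

-- σ(M): each edge {i, μ i} is counted once, at its smaller endpoint.
matchingWeight : {m : ℕ} → EdgeLabelling m → PerfectMatching m → ℤ
matchingWeight {m} σ M = ∑ m (λ i → edgeVal σ i (PerfectMatching.partner M i))

-- Colour the vertices with signs x and label each edge uv by −x_u x_v.  If S is the colour sum,
-- then 2σ(E) = 4n − S², while 2σ(M) ≡ 4n − 2S (mod 8) for every perfect matching M, because
-- −st = 1 − s − t − 4[s = t = −1] and every matching edge is seen from both of its endpoints.
-- For n = 4N² + 1 and S = 4N this gives σ(E) = 2 and σ(M) ≡ 2 (mod 4).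
module Submission where

open import Defs
open import Data.Nat as ℕ using (ℕ; zero; suc; _<_; _*_; _<ᵇ_; z≤n; s≤s)
import Data.Nat.Properties as ℕ
import Data.Nat.Tactic.RingSolver as ℕ-Solver
open import Data.Nat.Divisibility using (divides; ∣1⇒≡1)
open import Data.Integer as ℤ using (ℤ; +_; -_; _+_; _-_; ∣_∣)
import Data.Integer.Properties as ℤ
open import Data.Integer.Tactic.RingSolver using (solve-∀)
open import Data.Fin as Fin using (Fin; zero; suc; toℕ; _<?_)
import Data.Fin.Properties as Fin
open import Data.Fin.Permutation using (permutation)
open import Data.Bool using (if_then_else_)
open import Data.Product using (Σ; _×_; _,_)
open import Data.Empty using (⊥-elim)
open import Function using (_∘_)
open import Relation.Binary.PropositionalEquality
  using (_≡_; _≢_; refl; sym; trans; cong; cong₂; module ≡-Reasoning)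
open import Relation.Nullary using (yes; no)

open import Algebra.Properties.Semiring.Sum ℤ.+-*-semiring
  using (sum; sum-syntax; ∑-distrib-+; sum-permute; *-distribˡ-sum; sum-cong-≗)

∑≡sum : ∀ m (f : Fin m → ℤ) → ∑ m f ≡ sum f
∑≡sum zero    f = refl
∑≡sum (suc m) f = cong (_+_ (f zero)) (∑≡sum m (f ∘ suc))

sum-one : ∀ m → ∑[ i < m ] (+ 1) ≡ + m
sum-one zero    = refl
sum-one (suc m) = cong (_+_ (+ 1)) (sum-one m)

sum-neg : ∀ {m} (f : Fin m → ℤ) → ∑[ i < m ] (- f i) ≡ - sum f
sum-neg {zero}  f = refl
sum-neg {suc m} f = trans (cong (_+_ (- f zero)) (sum-neg (f ∘ suc)))
                          (sym (ℤ.neg-distrib-+ (f zero) (sum (f ∘ suc))))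

∑-distrib-− : ∀ {m} (f g : Fin m → ℤ) → ∑[ i < m ] (f i - g i) ≡ sum f - sum g
∑-distrib-− f g = trans (∑-distrib-+ f (-_ ∘ g)) (cong (_+_ (sum f)) (sum-neg g))

above : ∀ {m} → (Fin m → Fin m → ℤ) → Fin m → Fin m → ℤ
above h i j with i <? j
... | yes _ = h i j
... | no  _ = + 0

edgeVal≡above : ∀ {m} (σ : EdgeLabelling m) i j → edgeVal σ i j ≡ above (λ a b → ⟦ σ a b ⟧) i j
edgeVal≡above σ i j with i <? j
... | yes _ = refl
... | no  _ = refl

above-cong : ∀ {m} {h g : Fin m → Fin m → ℤ} → (∀ i j → h i j ≡ g i j) → ∀ i j → above h i j ≡ above g i j
above-cong h≡g i j with i <? j
... | yes _ = h≡g i j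
... | no  _ = refl

above-neg : ∀ {m} (h : Fin m → Fin m → ℤ) i j → above (λ a b → - h a b) i j ≡ - above h i j
above-neg h i j with i <? j
... | yes _ = refl
... | no  _ = refl

above-suc : ∀ {m} (h : Fin (suc m) → Fin (suc m) → ℤ) i j →
            above h (suc i) (suc j) ≡ above (λ a b → h (suc a) (suc b)) i j
above-suc h i j with suc i <? suc j | i <? j
... | yes _   | yes _   = refl
... | no  _   | no  _   = refl
... | yes i<j | no  i≮j = ⊥-elim (i≮j (ℕ.s≤s⁻¹ i<j))
... | no  i≮j | yes i<j = ⊥-elim (i≮j (s≤s i<j))

above-+-flip : ∀ {m} (h : Fin m → Fin m → ℤ) → (∀ i j → h i j ≡ h j i) →
               ∀ {i j} → i ≢ j → above h i j + above h j i ≡ h i j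
above-+-flip h h-sym {i} {j} i≢j with i <? j | j <? i
... | yes i<j | yes j<i = ⊥-elim (Fin.<-asym i<j j<i)
... | yes _   | no  _   = ℤ.+-identityʳ (h i j)
... | no  _   | yes _   = trans (ℤ.+-identityˡ (h j i)) (h-sym j i)
... | no  i≮j | no  j≮i = ⊥-elim (i≢j (Fin.≤-antisym (ℕ.≮⇒≥ j≮i) (ℕ.≮⇒≥ i≮j)))

sum-above-suc : ∀ {m} (h : Fin (suc m) → Fin (suc m) → ℤ) →
                ∑[ i < suc m ] ∑[ j < suc m ] above h i j
                ≡ ∑[ j < m ] h zero (suc j)
                  + ∑[ i < m ] ∑[ j < m ] above (λ a b → h (suc a) (suc b)) i j
sum-above-suc {m} h = cong₂ _+_ (ℤ.+-identityˡ (∑[ j < m ] h zero (suc j))) (sum-cong-≗ lower-row)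
  where
  lower-row : ∀ i → above h (suc i) zero + ∑[ j < m ] above h (suc i) (suc j)
                    ≡ ∑[ j < m ] above (λ a b → h (suc a) (suc b)) i j
  lower-row i = trans (ℤ.+-identityˡ _) (sum-cong-≗ (above-suc h i))

square-of-sum : ∀ {m} (a : Fin m → ℤ) →
                sum a ℤ.* sum a
                ≡ ∑[ i < m ] (a i ℤ.* a i) + + 2 ℤ.* ∑[ i < m ] ∑[ j < m ] above (λ i j → a i ℤ.* a j) i j
square-of-sum {zero}  a = refl
square-of-sum {suc m} a = begin
  (a₀ + S) ℤ.* (a₀ + S)                  ≡⟨ expand a₀ S ⟩
  a₀ ℤ.* a₀ + + 2 ℤ.* (a₀ ℤ.* S) + S ℤ.* S  ≡⟨ cong₂ (λ u v → a₀ ℤ.* a₀ + + 2 ℤ.* u + v)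
                                                     (*-distribˡ-sum a₀ (a ∘ suc))
                                                     (square-of-sum (a ∘ suc)) ⟩
  a₀ ℤ.* a₀ + + 2 ℤ.* R + (Q + + 2 ℤ.* T)    ≡⟨ regroup (a₀ ℤ.* a₀) R Q T ⟩
  (a₀ ℤ.* a₀ + Q) + + 2 ℤ.* (R + T)         ≡⟨ cong (λ u → (a₀ ℤ.* a₀ + Q) + + 2 ℤ.* u)
                                                  (sym (sum-above-suc (λ i j → a i ℤ.* a j))) ⟩
  ∑[ i < suc m ] (a i ℤ.* a i) + + 2 ℤ.* ∑[ i < suc m ] ∑[ j < suc m ] above (λ i j → a i ℤ.* a j) i j ∎
  where
  open ≡-Reasoning
  a₀ = a zero
  S  = sum (a ∘ suc)
  R  = ∑[ j < m ] (a₀ ℤ.* a (suc j))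
  Q  = ∑[ i < m ] (a (suc i) ℤ.* a (suc i))
  T  = ∑[ i < m ] ∑[ j < m ] above (λ i j → a (suc i) ℤ.* a (suc j)) i j
  expand : ∀ x y → (x + y) ℤ.* (x + y) ≡ x ℤ.* x + + 2 ℤ.* (x ℤ.* y) + y ℤ.* y
  expand = solve-∀
  regroup : ∀ x r q t → x + + 2 ℤ.* r + (q + + 2 ℤ.* t) ≡ (x + q) + + 2 ℤ.* (r + t)
  regroup = solve-∀

module _ {m} (M : PerfectMatching m) where
  open PerfectMatching M

  sum-partner : (f : Fin m → ℤ) → ∑[ i < m ] f (partner i) ≡ sum f
  sum-partner f = sym (sum-permute f (permutation partner partner involutive involutive))

  -- Each matching edge is seen from both of its endpoints, and above keeps exactly one of the two.
  sum-partner-above : (h : Fin m → Fin m → ℤ) → (∀ i j → h i j ≡ h j i) →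
                      ∑[ i < m ] h i (partner i) ≡ + 2 ℤ.* ∑[ i < m ] above h i (partner i)
  sum-partner-above h h-sym = begin
    ∑[ i < m ] h i (partner i)             ≡⟨ sum-cong-≗ (sym ∘ both-ends) ⟩
    ∑[ i < m ] (e i + e (partner i))       ≡⟨ ∑-distrib-+ e (e ∘ partner) ⟩
    sum e + ∑[ i < m ] e (partner i)       ≡⟨ cong (_+_ (sum e)) (sum-partner e) ⟩
    sum e + sum e                          ≡⟨ double (sum e) ⟩
    + 2 ℤ.* sum e                          ∎
    where
    open ≡-Reasoning
    e : Fin m → ℤ
    e i = above h i (partner i)
    both-ends : ∀ i → e i + e (partner i) ≡ h i (partner i)
    both-ends i = trans (cong (λ k → e i + above h (partner i) k) (involutive i))
                        (above-+-flip h h-sym (no-fixpoint i ∘ sym))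
    double : ∀ x → x + x ≡ + 2 ℤ.* x
    double = solve-∀

totalWeight≡ : ∀ {m} (σ : EdgeLabelling m) →
               totalWeight σ ≡ ∑[ i < m ] ∑[ j < m ] above (λ a b → ⟦ σ a b ⟧) i j
totalWeight≡ {m} σ = trans (∑≡sum m _) (sum-cong-≗ λ i → trans (∑≡sum m _) (sum-cong-≗ (edgeVal≡above σ i)))

matchingWeight≡ : ∀ {m} (σ : EdgeLabelling m) (M : PerfectMatching m) →
                  matchingWeight σ M
                  ≡ ∑[ i < m ] above (λ a b → ⟦ σ a b ⟧) i (PerfectMatching.partner M i)
matchingWeight≡ {m} σ M =
  trans (∑≡sum m _) (sum-cong-≗ λ i → edgeVal≡above σ i (PerfectMatching.partner M i))

differ : Sign → Sign → Sign
differ plus  plus  = minus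
differ plus  minus = plus
differ minus plus  = plus
differ minus minus = minus

isMinus : Sign → ℤ
isMinus plus  = + 0
isMinus minus = + 1

⟦differ⟧ : ∀ s t → ⟦ differ s t ⟧ ≡ - (⟦ s ⟧ ℤ.* ⟦ t ⟧)
⟦differ⟧ plus  plus  = refl
⟦differ⟧ plus  minus = refl
⟦differ⟧ minus plus  = refl
⟦differ⟧ minus minus = refl

⟦differ⟧-expand : ∀ s t → ⟦ differ s t ⟧ ≡ + 1 - ⟦ s ⟧ - ⟦ t ⟧ - + 4 ℤ.* (isMinus s ℤ.* isMinus t)
⟦differ⟧-expand plus  plus  = refl
⟦differ⟧-expand plus  minus = refl
⟦differ⟧-expand minus plus  = refl
⟦differ⟧-expand minus minus = refl

differ-comm : ∀ s t → differ s t ≡ differ t s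
differ-comm plus  plus  = refl
differ-comm plus  minus = refl
differ-comm minus plus  = refl
differ-comm minus minus = refl

⟦⟧-square : ∀ s → ⟦ s ⟧ ℤ.* ⟦ s ⟧ ≡ + 1
⟦⟧-square plus  = refl
⟦⟧-square minus = refl

colourLabelling : ∀ {m} → (Fin m → Sign) → EdgeLabelling m
colourLabelling x i j = differ (x i) (x j)

colourSum : ∀ {m} → (Fin m → Sign) → ℤ
colourSum {m} x = ∑[ i < m ] ⟦ x i ⟧

totalWeight-colourLabelling : ∀ {m} (x : Fin m → Sign) →
                              + 2 ℤ.* totalWeight (colourLabelling x) ≡ + m - colourSum x ℤ.* colourSum x
totalWeight-colourLabelling {m} x = begin
  + 2 ℤ.* totalWeight (colourLabelling x)  ≡⟨ cong (+ 2 ℤ.*_) (trans (totalWeight≡ (colourLabelling x)) negated) ⟩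
  + 2 ℤ.* - T                              ≡⟨ cancel (+ m) T ⟩
  + m - (+ m + + 2 ℤ.* T)                  ≡⟨ cong (λ u → + m - (u + + 2 ℤ.* T)) (sym diagonal) ⟩
  + m - (∑[ i < m ] (a i ℤ.* a i) + + 2 ℤ.* T) ≡⟨ cong (_-_ (+ m)) (sym (square-of-sum a)) ⟩
  + m - colourSum x ℤ.* colourSum x        ∎
  where
  open ≡-Reasoning
  a : Fin m → ℤ
  a i = ⟦ x i ⟧
  aa : Fin m → Fin m → ℤ
  aa i j = a i ℤ.* a j
  T = ∑[ i < m ] ∑[ j < m ] above aa i j
  pointwise : ∀ i j → above (λ i j → ⟦ differ (x i) (x j) ⟧) i j ≡ - above aa i j
  pointwise i j = trans (above-cong (λ i j → ⟦differ⟧ (x i) (x j)) i j) (above-neg aa i j)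
  negated : ∑[ i < m ] ∑[ j < m ] above (λ i j → ⟦ differ (x i) (x j) ⟧) i j ≡ - T
  negated = trans (sum-cong-≗ λ i → trans (sum-cong-≗ (pointwise i)) (sum-neg (above aa i)))
                  (sum-neg (λ i → ∑[ j < m ] above aa i j))
  diagonal : ∑[ i < m ] (a i ℤ.* a i) ≡ + m
  diagonal = trans (sum-cong-≗ (⟦⟧-square ∘ x)) (sum-one m)
  cancel : ∀ u t → + 2 ℤ.* - t ≡ u - (u + + 2 ℤ.* t)
  cancel = solve-∀

matchingWeight-colourLabelling : ∀ {m} (x : Fin m → Sign) (M : PerfectMatching m) →
                                 Σ ℤ λ k → + 2 ℤ.* matchingWeight (colourLabelling x) M
                                           ≡ + m - + 2 ℤ.* colourSum x - + 8 ℤ.* k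
matchingWeight-colourLabelling {m} x M = K , (begin
  + 2 ℤ.* matchingWeight (colourLabelling x) M
    ≡⟨ cong (+ 2 ℤ.*_) (matchingWeight≡ (colourLabelling x) M) ⟩
  + 2 ℤ.* ∑[ i < m ] above (λ u v → ⟦ differ (x u) (x v) ⟧) i (partner i)
    ≡⟨ sym (sum-partner-above M (λ u v → ⟦ differ (x u) (x v) ⟧) (λ u v → cong ⟦_⟧ (differ-comm (x u) (x v)))) ⟩
  ∑[ i < m ] ⟦ differ (x i) (x (partner i)) ⟧
    ≡⟨ sum-cong-≗ (λ i → ⟦differ⟧-expand (x i) (x (partner i))) ⟩
  ∑[ i < m ] (+ 1 - a i - a (partner i) - + 4 ℤ.* q i (partner i))
    ≡⟨ ∑-distrib-− (λ i → + 1 - a i - a (partner i)) (λ i → + 4 ℤ.* q i (partner i)) ⟩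
  ∑[ i < m ] (+ 1 - a i - a (partner i)) - ∑[ i < m ] (+ 4 ℤ.* q i (partner i))
    ≡⟨ cong₂ _-_ (trans (∑-distrib-− (λ i → + 1 - a i) (a ∘ partner))
                        (cong₂ _-_ (∑-distrib-− (λ _ → + 1) a) (sum-partner M a)))
                 (sym (*-distribˡ-sum (+ 4) (λ i → q i (partner i)))) ⟩
  ∑[ i < m ] (+ 1) - sum a - sum a - + 4 ℤ.* ∑[ i < m ] q i (partner i)
    ≡⟨ cong₂ (λ u v → u - sum a - sum a - + 4 ℤ.* v)
             (sum-one m) (sum-partner-above M q (λ u v → ℤ.*-comm (isMinus (x u)) (isMinus (x v)))) ⟩
  + m - sum a - sum a - + 4 ℤ.* (+ 2 ℤ.* K)
    ≡⟨ regroup (+ m) (sum a) K ⟩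
  + m - + 2 ℤ.* colourSum x - + 8 ℤ.* K ∎)
  where
  open ≡-Reasoning
  open PerfectMatching M
  a : Fin m → ℤ
  a i = ⟦ x i ⟧
  q : Fin m → Fin m → ℤ
  q u v = isMinus (x u) ℤ.* isMinus (x v)
  K = ∑[ i < m ] above q i (partner i)
  regroup : ∀ n s k → n - s - s - + 4 ℤ.* (+ 2 ℤ.* k) ≡ n - + 2 ℤ.* s - + 8 ℤ.* k
  regroup = solve-∀

totalWeight-colourLabelling≡2 : ∀ {m} (x : Fin m → Sign) → + m - colourSum x ℤ.* colourSum x ≡ + 4 →
                                totalWeight (colourLabelling x) ≡ + 2
totalWeight-colourLabelling≡2 x gap =
  ℤ.*-cancelˡ-≡ (+ 2) _ (+ 2) (trans (totalWeight-colourLabelling x) gap)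

1+2i≢0 : ∀ i → + 1 + + 2 ℤ.* i ≢ + 0
1+2i≢0 i eq = ℕ.1+n≢n (∣1⇒≡1 (divides ∣ - i ∣ 1≡∣-i∣*2))
  where
  split : ∀ i → + 1 ≡ (+ 1 + + 2 ℤ.* i) + + 2 ℤ.* - i
  split = solve-∀
  1≡2*[-i] : + 1 ≡ + 2 ℤ.* - i
  1≡2*[-i] = trans (split i) (trans (cong (_+ + 2 ℤ.* - i) eq) (ℤ.+-identityˡ _))
  1≡∣-i∣*2 : 1 ≡ ∣ - i ∣ * 2
  1≡∣-i∣*2 = trans (cong ∣_∣ 1≡2*[-i]) (trans (ℤ.abs-* (+ 2) (- i)) (ℕ.*-comm 2 ∣ - i ∣))

matchingWeight-colourLabelling≢0 : ∀ {m} (x : Fin m → Sign) (w : ℤ) →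
                                   + m - + 2 ℤ.* colourSum x ≡ + 4 + + 8 ℤ.* w →
                                   (M : PerfectMatching m) → matchingWeight (colourLabelling x) M ≢ + 0
matchingWeight-colourLabelling≢0 {m} x w gap M σM≡0 with matchingWeight-colourLabelling x M
... | k , 2σM≡ = 1+2i≢0 (w - k) (ℤ.*-cancelˡ-≡ (+ 4) _ (+ 0) (begin
  + 4 ℤ.* (+ 1 + + 2 ℤ.* (w - k))                     ≡⟨ expand w k ⟩
  (+ 4 + + 8 ℤ.* w) - + 8 ℤ.* k                       ≡⟨ cong (_- + 8 ℤ.* k) (sym gap) ⟩
  + m - + 2 ℤ.* colourSum x - + 8 ℤ.* k               ≡⟨ sym 2σM≡ ⟩
  + 2 ℤ.* matchingWeight (colourLabelling x) M         ≡⟨ cong (+ 2 ℤ.*_) σM≡0 ⟩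
  + 0                                                 ∎))
  where
  open ≡-Reasoning
  expand : ∀ w k → + 4 ℤ.* (+ 1 + + 2 ℤ.* (w - k)) ≡ (+ 4 + + 8 ℤ.* w) - + 8 ℤ.* k
  expand = solve-∀

firstPlus : ∀ {m} → ℕ → Fin m → Sign
firstPlus p i = if toℕ i <ᵇ p then plus else minus

colourSum-firstPlus : ∀ m p → p ℕ.≤ m → colourSum (firstPlus {m} p) ≡ + (p ℕ.+ p) - + m
colourSum-firstPlus zero    zero    z≤n       = refl
colourSum-firstPlus (suc m) zero    z≤n       =
  trans (cong (_+_ ⟦ minus ⟧) (colourSum-firstPlus m zero z≤n)) (shift (+ m))
  where
  shift : ∀ t → ⟦ minus ⟧ + (+ 0 - t) ≡ + 0 - (+ 1 + t)
  shift = solve-∀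
colourSum-firstPlus (suc m) (suc p) (s≤s p≤m) =
  trans (cong (_+_ (+ 1)) (colourSum-firstPlus m p p≤m))
        (trans (shift (+ (p ℕ.+ p)) (+ m)) (cong (λ k → + suc k - + suc m) (sym (ℕ.+-suc p p))))
  where
  shift : ∀ s t → + 1 + (s - t) ≡ (+ 2 + s) - (+ 1 + t)
  shift = solve-∀

n≤4*[n*n] : ∀ n → n ℕ.≤ 4 * (n * n)
n≤4*[n*n] zero      = z≤n
n≤4*[n*n] n@(suc _) = ℕ.≤-trans (ℕ.m≤m*n n n) (ℕ.m≤n*m (n * n) 4)

module Construction (N : ℕ) where

  n : ℕ
  n = suc (4 * (N * N))

  N<n : N < n
  N<n = s≤s (n≤4*[n*n] N)

  plusCount : ℕ
  plusCount = 2 * n ℕ.+ 2 * N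

  colouring : Fin (4 * n) → Sign
  colouring = firstPlus plusCount

  plusCount≤4n : plusCount ℕ.≤ 4 * n
  plusCount≤4n = ℕ.≤-trans (ℕ.+-monoʳ-≤ (2 * n) (ℕ.*-monoʳ-≤ 2 (ℕ.<⇒≤ N<n))) (ℕ.≤-reflexive (double n))
    where
    double : ∀ n → 2 * n ℕ.+ 2 * n ≡ 4 * n
    double = ℕ-Solver.solve-∀

  vertexCount : + (4 * n) ≡ + 4 ℤ.* (+ 1 + + 4 ℤ.* (+ N ℤ.* + N))
  vertexCount = trans (ℤ.pos-* 4 n) (cong (λ k → + 4 ℤ.* (+ 1 + k))
                                      (trans (ℤ.pos-* 4 (N * N)) (cong (+ 4 ℤ.*_) (ℤ.pos-* N N))))

  colourSum-colouring : colourSum colouring ≡ + 4 ℤ.* + N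
  colourSum-colouring = begin
    colourSum colouring                      ≡⟨ colourSum-firstPlus (4 * n) plusCount plusCount≤4n ⟩
    + (plusCount ℕ.+ plusCount) - + (4 * n)  ≡⟨ cong (λ k → + k - + (4 * n)) (twice n N) ⟩
    + (4 * N ℕ.+ 4 * n) - + (4 * n)          ≡⟨ cong (_- + (4 * n)) (ℤ.pos-+ (4 * N) (4 * n)) ⟩
    (+ (4 * N) + + (4 * n)) - + (4 * n)      ≡⟨ cancel (+ (4 * N)) (+ (4 * n)) ⟩
    + (4 * N)                                ≡⟨ ℤ.pos-* 4 N ⟩
    + 4 ℤ.* + N                              ∎
    where
    open ≡-Reasoning
    twice : ∀ n N → (2 * n ℕ.+ 2 * N) ℕ.+ (2 * n ℕ.+ 2 * N) ≡ 4 * N ℕ.+ 4 * n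
    twice = ℕ-Solver.solve-∀
    cancel : ∀ s t → (s + t) - t ≡ s
    cancel = solve-∀

  square-gap : + (4 * n) - colourSum colouring ℤ.* colourSum colouring ≡ + 4
  square-gap = trans (cong₂ (λ m s → m - s ℤ.* s) vertexCount colourSum-colouring) (identity (+ N))
    where
    identity : ∀ ν → + 4 ℤ.* (+ 1 + + 4 ℤ.* (ν ℤ.* ν)) - (+ 4 ℤ.* ν) ℤ.* (+ 4 ℤ.* ν) ≡ + 4
    identity = solve-∀

  excess : ℤ
  excess = + 2 ℤ.* (+ N ℤ.* + N) - + N

  linear-gap : + (4 * n) - + 2 ℤ.* colourSum colouring ≡ + 4 + + 8 ℤ.* excess
  linear-gap = trans (cong₂ (λ m s → m - + 2 ℤ.* s) vertexCount colourSum-colouring) (identity (+ N))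
    where
    identity : ∀ ν → + 4 ℤ.* (+ 1 + + 4 ℤ.* (ν ℤ.* ν)) - + 2 ℤ.* (+ 4 ℤ.* ν)
                     ≡ + 4 + + 8 ℤ.* (+ 2 ℤ.* (ν ℤ.* ν) - ν)
    identity = solve-∀

proposition2 : (N : ℕ) → Σ ℕ (λ n → (N < n) × (0 < n) ×
                 Σ (EdgeLabelling (4 * n)) (λ σ →
                   (totalWeight σ ≡ + 2) ×
                   ((M : PerfectMatching (4 * n)) → matchingWeight σ M ≢ + 0)))
proposition2 N =
  n , N<n , s≤s z≤n , colourLabelling colouring ,
  totalWeight-colourLabelling≡2 colouring square-gap ,
  matchingWeight-colourLabelling≢0 colouring excess linear-gap
  where open Construction N
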